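{- For every integer $k>0$ there exists $V\subseteq\mathbb{R}^2$ with $|V|=2^k$ such that $\mathsf{DISJ}_k\preceq\mathsf{PromiseCSD}_V$.
   Context: $\mathsf{DISJ}_k:\{0,1\}^k\times\{0,1\}^k\to\{0,1\}$ is $0$ if there is $i$ with $x_i=y_i=1$ and $1$ otherwise. $\mathsf{PromiseCSD}_V$ is the partial function on $2^V\times 2^V$ with value $0$ if $X\cap Y\neq\emptyset$, value $1$ if $\mathrm{conv}(X)\cap\mathrm{conv}(Y)=\emptyset$, undefined otherwise. $f_1\preceq f_2$ means there exist maps $\alpha,\beta$ of Alice's and Bob's inputs respectively such that for all $(x,y)$ in the domain of $f_1$, $(\alpha(x),\beta(y))$ lies in the domain of $f_2$ and $f_1(x,y)=f_2(\alpha(x),\beta(y))$.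
   Formalization: The points of V are taken with rational coordinates rather than in $\mathbb{R}^2$, and the convex hulls are taken with rational weights. -}

module Defs where

open import Data.Nat using (ℕ; zero; suc; _^_)
open import Data.Bool using (Bool; true; false; _∧_; _∨_; not)
open import Data.Fin using (Fin; zero; suc)
open import Data.Fin.Subset using (Subset; _∈_; _∉_)
open import Data.Product using (_×_; _,_; ∃; ∃-syntax; Σ-syntax)
open import Data.Rational using (ℚ; 0ℚ; 1ℚ; _+_; _*_; _≤_)
open import Relation.Binary.PropositionalEquality using (_≡_)
open import Relation.Nullary using (¬_)
open import Function.Definitions using (Injective)

Point : Set
Point = ℚ × ℚ

Bits : ℕ → Set
Bits k = Fin k → Bool

anyFin : {k : ℕ} → (Fin k → Bool) → Bool
anyFin {zero}  f = false
anyFin {suc k} f = f zero ∨ anyFin (λ i → f (suc i))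

-- DISJ_k x y = false (i.e. 0) iff ∃ i. x_i = y_i = 1; true (i.e. 1) otherwise.
DISJ : (k : ℕ) → Bits k → Bits k → Bool
DISJ k x y = not (anyFin (λ i → x i ∧ y i))

sumFin : {n : ℕ} → (Fin n → ℚ) → ℚ
sumFin {zero}  f = 0ℚ
sumFin {suc n} f = f zero + sumFin (λ i → f (suc i))

-- A point set V of size n in the plane: an injective indexing Fin n → Point.
-- Subsets of V are represented by subsets of the index set Fin n.

InConv : {n : ℕ} → (Fin n → Point) → Subset n → Point → Set
InConv {n} V X (px , py) =
  Σ[ w ∈ (Fin n → ℚ) ]
    ((∀ i → 0ℚ ≤ w i)
    × (∀ i → i ∉ X → w i ≡ 0ℚ)
    × sumFin w ≡ 1ℚ
    × sumFin (λ i → w i * Data.Product.proj₁ (V i)) ≡ px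
    × sumFin (λ i → w i * Data.Product.proj₂ (V i)) ≡ py)

Meets : {n : ℕ} → Subset n → Subset n → Set
Meets X Y = ∃[ i ] (i ∈ X × i ∈ Y)

ConvDisjoint : {n : ℕ} → (Fin n → Point) → Subset n → Subset n → Set
ConvDisjoint V X Y = ¬ (∃[ p ] (InConv V X p × InConv V Y p))

-- PromiseCSD_V as a relation: "PromiseCSD V X Y b" means (X , Y) lies in
-- the domain and PromiseCSD_V(X , Y) = b (false = 0, true = 1).
PromiseCSD : {n : ℕ} → (Fin n → Point) → Subset n → Subset n → Bool → Set
PromiseCSD V X Y false = Meets X Y
PromiseCSD V X Y true  = ConvDisjoint V X Y

-- f₁ ⪯ f₂ for a total f₁ : A × B → Bool and a partial f₂ given as a
-- graph relation R (R x y b : (x , y) ∈ dom f₂ and f₂ x y = b).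
_⪯_ : {A B C D : Set} → (A → B → Bool) → (C → D → Bool → Set) → Set
_⪯_ {A} {B} {C} {D} f₁ R =
  Σ[ α ∈ (A → C) ] Σ[ β ∈ (B → D) ] (∀ x y → R (α x) (β y) (f₁ x y))

open Data.Product public using (Σ-syntax; _×_; _,_)

-- Put the 2^k points (i, i²) on the parabola y = x², one for each bit string. The
-- tangent line at the point of j passes through it, while every other point lies above
-- it by (i - j)² ≥ 1; hence no point is in the convex hull of other points. Alice maps
-- x to its own point, Bob maps y to the points of all strings that meet y: if x meets
-- y the two sets share a point, and otherwise Bob's set misses Alice's point, so the
-- tangent there separates the two convex hulls.
module Submission where

open import Defs
open import Data.Nat using (ℕ; _<_; _^_)
open import Data.Fin using (Fin)
open import Function.Definitions using (Injective)
open import Relation.Binary.PropositionalEquality using (_≡_)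

open import Algebra.Bundles using (CommutativeRing)
import Algebra.Properties.Semiring.Sum as Sum
open import Data.Bool using (Bool; true; false; _∧_; _∨_; not)
open import Data.Bool.Properties using (not-¬)
open import Data.Empty using (⊥-elim)
open import Data.Fin using (zero; suc; toℕ; funToFin; finToFun)
open import Data.Fin.Properties using (toℕ-injective; finToFun-funToFin; 2↔Bool; _≟_)
open import Data.Fin.Subset using (Subset; _∈_; _∉_; ⁅_⁆)
open import Data.Fin.Subset.Properties using (x∈⁅x⁆; x∈⁅y⁆⇒x≡y; _∈?_)
import Data.Nat as ℕ
import Data.Nat.Properties as ℕ
open import Data.Product using (proj₁; proj₂)
open import Data.Rational using (ℚ; 0ℚ; 1ℚ; -_; _+_; _-_; _*_; _≤_; nonNegative)
import Data.Rational as ℚ using (_<_)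
import Data.Rational.Properties as ℚ
open import Data.Rational.Solver using (module +-*-Solver)
open import Data.Vec using (tabulate; lookup)
open import Data.Vec.Properties using (lookup∘tabulate; []=⇒lookup; lookup⇒[]=)
open import Function using (_∘_; Inverse)
open import Relation.Binary.Definitions using (tri<; tri≈; tri>)
open import Relation.Binary.PropositionalEquality using (_≢_; refl; sym; trans; cong; cong₂; subst; _≗_; module ≡-Reasoning)
open import Relation.Nullary using (yes; no)

open Sum (CommutativeRing.semiring ℚ.+-*-commutativeRing) using (sum; ∑-distrib-+; *-distribˡ-sum; *-distribʳ-sum; sum-cong-≗)
open +-*-Solver using (solve; con; _:+_; _:*_; :-_; _:=_)

private
  variable
    n k : ℕ

sumFin≡sum : (f : Fin n → ℚ) → sumFin f ≡ sum f
sumFin≡sum {ℕ.zero}  f = refl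
sumFin≡sum {ℕ.suc n} f = cong (f zero +_) (sumFin≡sum (f ∘ suc))

sumFin-mono-≤ : {f g : Fin n → ℚ} → (∀ i → f i ≤ g i) → sumFin f ≤ sumFin g
sumFin-mono-≤ {ℕ.zero}  f≤g = ℚ.≤-refl
sumFin-mono-≤ {ℕ.suc n} f≤g = ℚ.+-mono-≤ (f≤g zero) (sumFin-mono-≤ (f≤g ∘ suc))

IsConvexWeighting : Subset n → (Fin n → ℚ) → Set
IsConvexWeighting X w = (∀ i → 0ℚ ≤ w i) × (∀ i → i ∉ X → w i ≡ 0ℚ) × sumFin w ≡ 1ℚ

weightedSum-mono-≤ : {X : Subset n} {w f g : Fin n → ℚ} → IsConvexWeighting X w →
  (∀ i → i ∈ X → f i ≤ g i) → sumFin (λ i → w i * f i) ≤ sumFin (λ i → w i * g i)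
weightedSum-mono-≤ {X = X} {w} {f} {g} (w≥0 , w-outside , _) f≤g = sumFin-mono-≤ termwise
  where
  termwise : ∀ i → w i * f i ≤ w i * g i
  termwise i with i ∈? X
  ... | yes i∈X = ℚ.*-monoˡ-≤-nonNeg (w i) {{nonNegative (w≥0 i)}} (f≤g i i∈X)
  ... | no  i∉X rewrite w-outside i i∉X | ℚ.*-zeroˡ (f i) | ℚ.*-zeroˡ (g i) = ℚ.≤-refl

weightedSum-const : {X : Subset n} {w : Fin n → ℚ} → IsConvexWeighting X w →
  ∀ c → sumFin (λ i → w i * c) ≡ c
weightedSum-const {w = w} (_ , _ , Σw≡1) c = begin
  sumFin (λ i → w i * c) ≡⟨ sumFin≡sum (λ i → w i * c) ⟩
  sum (λ i → w i * c)    ≡⟨ *-distribʳ-sum c w ⟨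
  sum w * c              ≡⟨ cong (_* c) (trans (sym (sumFin≡sum w)) Σw≡1) ⟩
  1ℚ * c                 ≡⟨ ℚ.*-identityˡ c ⟩
  c                      ∎
  where open ≡-Reasoning

infix 7 _·_

_·_ : Point → Point → ℚ
(u₁ , u₂) · (a , b) = u₁ * a + u₂ * b

·-weightedSum : (u : Point) (w : Fin n → ℚ) (V : Fin n → Point) →
  u · (sumFin (λ i → w i * proj₁ (V i)) , sumFin (λ i → w i * proj₂ (V i)))
    ≡ sumFin (λ i → w i * (u · V i))
·-weightedSum (u₁ , u₂) w V = begin
  u₁ * sumFin wx + u₂ * sumFin wy
    ≡⟨ cong₂ (λ a b → u₁ * a + u₂ * b) (sumFin≡sum wx) (sumFin≡sum wy) ⟩
  u₁ * sum wx + u₂ * sum wy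
    ≡⟨ cong₂ _+_ (*-distribˡ-sum u₁ wx) (*-distribˡ-sum u₂ wy) ⟩
  sum (λ i → u₁ * wx i) + sum (λ i → u₂ * wy i)
    ≡⟨ ∑-distrib-+ (λ i → u₁ * wx i) (λ i → u₂ * wy i) ⟨
  sum (λ i → u₁ * wx i + u₂ * wy i)
    ≡⟨ sum-cong-≗ (λ i → regroup (w i) (proj₁ (V i)) (proj₂ (V i))) ⟩
  sum (λ i → w i * ((u₁ , u₂) · V i))
    ≡⟨ sumFin≡sum (λ i → w i * ((u₁ , u₂) · V i)) ⟨
  sumFin (λ i → w i * ((u₁ , u₂) · V i)) ∎
  where
  open ≡-Reasoning
  wx wy : Fin _ → ℚ
  wx i = w i * proj₁ (V i)
  wy i = w i * proj₂ (V i)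
  regroup : ∀ c a b → u₁ * (c * a) + u₂ * (c * b) ≡ c * (u₁ * a + u₂ * b)
  regroup = solve 5 (λ u₁ u₂ c a b → u₁ :* (c :* a) :+ u₂ :* (c :* b) := c :* (u₁ :* a :+ u₂ :* b))
    refl u₁ u₂

module _ {V : Fin n → Point} {X : Subset n} (u : Point) where

  InConv⇒·≤ : ∀ {p a} → InConv V X p → (∀ i → i ∈ X → u · V i ≤ a) → u · p ≤ a
  InConv⇒·≤ {a = a} (w , w≥0 , w-outside , Σw≡1 , refl , refl) ·≤a = begin
    u · _                         ≡⟨ ·-weightedSum u w V ⟩
    sumFin (λ i → w i * (u · V i)) ≤⟨ weightedSum-mono-≤ weighting ·≤a ⟩
    sumFin (λ i → w i * a)         ≡⟨ weightedSum-const weighting a ⟩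
    a                             ∎
    where
    open ℚ.≤-Reasoning
    weighting = w≥0 , w-outside , Σw≡1

  InConv⇒≤· : ∀ {p a} → InConv V X p → (∀ i → i ∈ X → a ≤ u · V i) → a ≤ u · p
  InConv⇒≤· {a = a} (w , w≥0 , w-outside , Σw≡1 , refl , refl) a≤· = begin
    a                             ≡⟨ weightedSum-const weighting a ⟨
    sumFin (λ i → w i * a)         ≤⟨ weightedSum-mono-≤ weighting a≤· ⟩
    sumFin (λ i → w i * (u · V i)) ≡⟨ ·-weightedSum u w V ⟨
    u · _                         ∎
    where
    open ℚ.≤-Reasoning
    weighting = w≥0 , w-outside , Σw≡1

separated⇒ConvDisjoint : {V : Fin n → Point} {X Y : Subset n} (u : Point) {a b : ℚ} → a ℚ.< b →
  (∀ i → i ∈ X → u · V i ≤ a) → (∀ i → i ∈ Y → b ≤ u · V i) → ConvDisjoint V X Y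
separated⇒ConvDisjoint u a<b X≤a b≤Y (p , p∈convX , p∈convY) =
  ℚ.<-irrefl refl (ℚ.<-≤-trans a<b (ℚ.≤-trans (InConv⇒≤· u p∈convY b≤Y) (InConv⇒·≤ u p∈convX X≤a)))

fromℕ : ℕ → ℚ
fromℕ ℕ.zero    = 0ℚ
fromℕ (ℕ.suc m) = fromℕ m + 1ℚ

fromℕ-nonNeg : ∀ m → 0ℚ ≤ fromℕ m
fromℕ-nonNeg ℕ.zero    = ℚ.≤-refl
fromℕ-nonNeg (ℕ.suc m) = ℚ.+-mono-≤ (fromℕ-nonNeg m) (ℚ.nonNegative⁻¹ 1ℚ)

fromℕ-mono-≤ : ∀ {m n} → m ℕ.≤ n → fromℕ m ≤ fromℕ n
fromℕ-mono-≤ {n = n} ℕ.z≤n   = fromℕ-nonNeg n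
fromℕ-mono-≤ (ℕ.s≤s m≤n) = ℚ.+-monoˡ-≤ 1ℚ (fromℕ-mono-≤ m≤n)

1≤p⇒1≤p*p : ∀ {p} → 1ℚ ≤ p → 1ℚ ≤ p * p
1≤p⇒1≤p*p {p} 1≤p = begin
  1ℚ     ≤⟨ 1≤p ⟩
  p      ≡⟨ ℚ.*-identityʳ p ⟨
  p * 1ℚ ≤⟨ ℚ.*-monoˡ-≤-nonNeg p {{nonNegative (ℚ.≤-trans (ℚ.nonNegative⁻¹ 1ℚ) 1≤p)}} 1≤p ⟩
  p * p  ∎
  where open ℚ.≤-Reasoning

p+1≤q⇒1≤[q-p]² : ∀ {p q} → p + 1ℚ ≤ q → 1ℚ ≤ (q - p) * (q - p)
p+1≤q⇒1≤[q-p]² {p} {q} p+1≤q = 1≤p⇒1≤p*p (begin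
  1ℚ              ≡⟨ solve 2 (λ p o → o := (p :+ o) :+ :- p) refl p 1ℚ ⟩
  (p + 1ℚ) - p    ≤⟨ ℚ.+-monoˡ-≤ (- p) p+1≤q ⟩
  q - p           ∎)
  where open ℚ.≤-Reasoning

1≤[fromℕ-difference]² : ∀ {m n} → m ≢ n → 1ℚ ≤ (fromℕ m - fromℕ n) * (fromℕ m - fromℕ n)
1≤[fromℕ-difference]² {m} {n} m≢n with ℕ.<-cmp m n
... | tri< m<n _ _ = ℚ.≤-trans (p+1≤q⇒1≤[q-p]² (fromℕ-mono-≤ m<n)) (ℚ.≤-reflexive square-swap)
  where
  square-swap : (fromℕ n - fromℕ m) * (fromℕ n - fromℕ m) ≡ (fromℕ m - fromℕ n) * (fromℕ m - fromℕ n)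
  square-swap =
    solve 2 (λ a b → (b :+ :- a) :* (b :+ :- a) := (a :+ :- b) :* (a :+ :- b)) refl (fromℕ m) (fromℕ n)
... | tri≈ _ m≡n _ = ⊥-elim (m≢n m≡n)
... | tri> _ _ m>n = p+1≤q⇒1≤[q-p]² (fromℕ-mono-≤ m>n)

onParabola : ℚ → Point
onParabola r = r , r * r

tangentNormal : ℚ → Point
tangentNormal s = - (s + s) , 1ℚ

tangentNormal-·-onParabola : ∀ s r → tangentNormal s · onParabola r ≡ (r - s) * (r - s) - s * s
tangentNormal-·-onParabola = solve 2 (λ s r →
  (:- (s :+ s)) :* r :+ con 1ℚ :* (r :* r) := (r :+ :- s) :* (r :+ :- s) :+ :- (s :* s)) refl

-p<1-p : ∀ p → - p ℚ.< 1ℚ - p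
-p<1-p p = subst (ℚ._< 1ℚ - p) (ℚ.+-identityˡ (- p)) (ℚ.+-monoˡ-< (- p) (ℚ.positive⁻¹ 1ℚ))

position : Fin n → ℚ
position = fromℕ ∘ toℕ

parabola : Fin n → Point
parabola = onParabola ∘ position

tangent-touches : (j : Fin n) → tangentNormal (position j) · parabola j ≡ - (position j * position j)
tangent-touches j =
  solve 1 (λ s → (:- (s :+ s)) :* s :+ con 1ℚ :* (s :* s) := :- (s :* s)) refl (position j)

tangent-separates : {i j : Fin n} → i ≢ j →
  1ℚ - position j * position j ≤ tangentNormal (position j) · parabola i
tangent-separates {i = i} {j} i≢j = begin
  1ℚ - s * s
    ≤⟨ ℚ.+-monoˡ-≤ (- (s * s)) (1≤[fromℕ-difference]² (i≢j ∘ toℕ-injective)) ⟩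
  (position i - s) * (position i - s) - s * s
    ≡⟨ tangentNormal-·-onParabola s (position i) ⟨
  tangentNormal s · parabola i ∎
  where
  open ℚ.≤-Reasoning
  s = position j

parabola-injective : Injective _≡_ _≡_ (parabola {n})
parabola-injective {x = i} {j} Vi≡Vj with i ≟ j
... | yes i≡j = i≡j
... | no  i≢j = ⊥-elim (ℚ.<-irrefl refl (ℚ.<-≤-trans (-p<1-p (s * s)) (begin
  1ℚ - s * s                   ≤⟨ tangent-separates i≢j ⟩
  tangentNormal s · parabola i ≡⟨ cong (tangentNormal s ·_) Vi≡Vj ⟩
  tangentNormal s · parabola j ≡⟨ tangent-touches j ⟩
  - (s * s)                    ∎)))
  where
  open ℚ.≤-Reasoning
  s = position j

ConvexPosition : (Fin n → Point) → Set
ConvexPosition {n} V = ∀ j (Y : Subset n) → j ∉ Y → ConvDisjoint V ⁅ j ⁆ Y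

parabola-convexPosition : ConvexPosition (parabola {n})
parabola-convexPosition j Y j∉Y =
  separated⇒ConvDisjoint (tangentNormal s) (-p<1-p (s * s)) touches separates
  where
  s = position j
  touches : ∀ i → i ∈ ⁅ j ⁆ → tangentNormal s · parabola i ≤ - (s * s)
  touches i i∈⁅j⁆ rewrite x∈⁅y⁆⇒x≡y j i∈⁅j⁆ = ℚ.≤-reflexive (tangent-touches j)
  separates : ∀ i → i ∈ Y → 1ℚ - s * s ≤ tangentNormal s · parabola i
  separates i i∈Y = tangent-separates {i = i} {j} (λ { refl → j∉Y i∈Y })

encode : Bits k → Fin (2 ^ k)
encode x = funToFin (Inverse.from 2↔Bool ∘ x)

decode : Fin (2 ^ k) → Bits k
decode i = Inverse.to 2↔Bool ∘ finToFun i

decode-encode : (x : Bits k) → decode (encode x) ≗ x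
decode-encode x t = trans (cong (Inverse.to 2↔Bool) (finToFun-funToFin (Inverse.from 2↔Bool ∘ x) t))
                          (Inverse.strictlyInverseˡ 2↔Bool (x t))

anyFin-cong : {f g : Fin k → Bool} → f ≗ g → anyFin f ≡ anyFin g
anyFin-cong {ℕ.zero}  f≗g = refl
anyFin-cong {ℕ.suc k} f≗g = cong₂ _∨_ (f≗g zero) (anyFin-cong (f≗g ∘ suc))

DISJ-congˡ : {x x′ : Bits k} → x ≗ x′ → ∀ y → DISJ k x y ≡ DISJ k x′ y
DISJ-congˡ x≗x′ y = cong not (anyFin-cong (λ t → cong (_∧ y t) (x≗x′ t)))

meeting : Bits k → Subset (2 ^ k)
meeting {k} y = tabulate (λ i → not (DISJ k (decode i) y))

lookup-meeting-encode : (x y : Bits k) → lookup (meeting y) (encode x) ≡ not (DISJ k x y)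
lookup-meeting-encode {k} x y =
  trans (lookup∘tabulate (λ i → not (DISJ k (decode i) y)) (encode x))
        (cong not (DISJ-congˡ (decode-encode x) y))

encode∈meeting : (x y : Bits k) → DISJ k x y ≡ false → encode x ∈ meeting y
encode∈meeting x y x∩y≢∅ =
  lookup⇒[]= (encode x) (meeting y) (trans (lookup-meeting-encode x y) (cong not x∩y≢∅))

encode∉meeting : (x y : Bits k) → DISJ k x y ≡ true → encode x ∉ meeting y
encode∉meeting x y x∩y≡∅ x∈meeting =
  not-¬ ([]=⇒lookup x∈meeting) (trans (lookup-meeting-encode x y) (cong not x∩y≡∅))

DISJ⪯PromiseCSD : {V : Fin (2 ^ k) → Point} → ConvexPosition V → DISJ k ⪯ PromiseCSD V
DISJ⪯PromiseCSD {k} {V} convex = (λ x → ⁅ encode x ⁆) , meeting , reduction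
  where
  reduction : ∀ x y → PromiseCSD V ⁅ encode x ⁆ (meeting y) (DISJ k x y)
  reduction x y with DISJ k x y in eq
  ... | false = encode x , x∈⁅x⁆ (encode x) , encode∈meeting x y eq
  ... | true  = convex (encode x) (meeting y) (encode∉meeting x y eq)

mainTheorem13 : (k : ℕ) → 0 < k →
    Σ[ V ∈ (Fin (2 ^ k) → Point) ] (Injective _≡_ _≡_ V × (DISJ k ⪯ PromiseCSD V))
mainTheorem13 k _ = parabola , parabola-injective , DISJ⪯PromiseCSD parabola-convexPosition
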